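{- For integers $a,b$ with $0\le a\le b/2$, the finite sequence $(\mathcal{G}(0,a,b),\mathcal{G}(0,a+1,b),\ldots,\mathcal{G}(0,b-a,b))$ is a palindrome (it reads the same forwards and backwards).
   Context: Three-pile Sharing Nim: a position is a triple of nonnegative integers (pile sizes; order irrelevant). A move takes some positive number $k$ of tokens from one pile and adds them to another pile, provided that after the move the receiving pile does not have more tokens than the source pile; i.e. from $(a,b,c)$ with $a\le b\le c$ one may move to $(a+k,b-k,c)$ with $1\le k\le (b-a)/2$, to $(a+k,b,c-k)$ with $1\le k\le (c-a)/2$, or to $(a,b+k,c-k)$ with $1\le k\le (c-b)/2$. Normal play. $\mathcal{G}$ denotes the Sprague–Grundy value: $\mathcal{G}(p)=\operatorname{mex}\{\mathcal{G}(q): q \text{ reachable from } p \text{ in one move}\}$, where $\operatorname{mex}(S)$ is the least nonnegative integer not in $S$. -}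

module Defs where

open import Data.Nat using (ℕ; zero; suc; _+_; _∸_; _≤_; _<_)
open import Data.Product using (_×_; _,_; ∃)
open import Relation.Binary.PropositionalEquality using (_≡_)
open import Relation.Nullary using (¬_)

-- A position of three-pile Sharing Nim: a triple of pile sizes.
-- Order is irrelevant: moves are allowed between any ordered pair of piles.
Pos : Set
Pos = ℕ × ℕ × ℕ

-- Move from source pile of size s to receiver pile of size r, k tokens:
-- allowed iff 1 ≤ k and the receiver afterwards (r + k) does not exceed
-- the source afterwards (s - k), i.e. r + k + k ≤ s.
Legal : ℕ → ℕ → ℕ → Set
Legal s r k = (1 ≤ k) × (r + k + k ≤ s)

data Move : Pos → Pos → Set where
  xy : ∀ {x y z} k → Legal x y k → Move (x , y , z) (x ∸ k , y + k , z)
  xz : ∀ {x y z} k → Legal x z k → Move (x , y , z) (x ∸ k , y , z + k)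
  yx : ∀ {x y z} k → Legal y x k → Move (x , y , z) (x + k , y ∸ k , z)
  yz : ∀ {x y z} k → Legal y z k → Move (x , y , z) (x , y ∸ k , z + k)
  zx : ∀ {x y z} k → Legal z x k → Move (x , y , z) (x + k , y , z ∸ k)
  zy : ∀ {x y z} k → Legal z y k → Move (x , y , z) (x , y + k , z ∸ k)

IsMexOfOptions : (Pos → ℕ) → Pos → ℕ → Set
IsMexOfOptions g p n =
  (∀ q → Move p q → ¬ (g q ≡ n)) ×
  (∀ m → m < n → ∃ λ q → Move p q × (g q ≡ m))

-- g is the Sprague–Grundy function: g p = mex { g q : p → q }.
-- (The game is finite -- each move strictly decreases the sum of squares
-- of the piles -- so exactly one such g exists.)
IsGrundy : (Pos → ℕ) → Set
IsGrundy g = ∀ p → IsMexOfOptions g p (g p)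

-- On positions whose piles are all at most c, the map (x , y , z) ↦ (c ∸ z , c ∸ y , c ∸ x)
-- is an involution taking moves to moves: a transfer of k tokens from a pile s to a pile r
-- becomes a transfer of k tokens from c ∸ r to c ∸ s.  Since every move decreases the sum
-- of the squares of the piles, well-founded induction shows that such a symmetry preserves
-- Grundy values, the options of p and of its image having the same values.  For c = b it
-- sends (0 , y , b) to (0 , b ∸ y , b), which pairs up the j-th and (b ∸ 2a ∸ j)-th terms.

module Submission where

open import Defs
open import Data.Nat using (ℕ; suc; _+_; _∸_; _≤_)
open import Data.List using (map; upTo; reverse)
open import Data.Product using (_,_)
open import Relation.Binary.PropositionalEquality using (_≡_)

open import Data.Empty using (⊥-elim)
open import Data.List using (_∷_; applyUpTo; applyDownFrom)
open import Data.List.Properties using (map-upTo; reverse-applyUpTo)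
open import Data.Nat using (zero; _*_; _<_; z≤n; s≤s; s≤s⁻¹; >-nonZero)
open import Data.Nat.Induction using (<-wellFounded)
open import Data.Nat.Properties
open import Data.Nat.Tactic.RingSolver using (solve-∀)
open import Data.Product using (_×_; ∃; proj₁; proj₂)
open import Induction.WellFounded using (Acc; acc)
open import Relation.Binary.Definitions using (tri<; tri≈; tri>)
open import Relation.Binary.PropositionalEquality
  using (refl; sym; trans; cong; cong₂; subst; subst₂; module ≡-Reasoning)
open import Relation.Nullary using (¬_)
open import Algebra.Properties.CommutativeSemigroup +-commutativeSemigroup
  using (interchange; xy∙z≈xz∙y)

applyDownFrom-applyUpTo : ∀ {A : Set} (f : ℕ → A) n →
  applyDownFrom f n ≡ applyUpTo (λ j → f (n ∸ suc j)) n
applyDownFrom-applyUpTo f zero    = refl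
applyDownFrom-applyUpTo f (suc n) = cong (f n ∷_) (applyDownFrom-applyUpTo f n)

applyUpTo-cong : ∀ {A : Set} {f h : ℕ → A} n → (∀ j → j < n → f j ≡ h j) →
  applyUpTo f n ≡ applyUpTo h n
applyUpTo-cong zero    f≡h = refl
applyUpTo-cong (suc n) f≡h =
  cong₂ _∷_ (f≡h 0 (s≤s z≤n)) (applyUpTo-cong n (λ j j<n → f≡h (suc j) (s≤s j<n)))

map-upTo-palindrome : ∀ {A : Set} (f : ℕ → A) n → (∀ j → j ≤ n → f (n ∸ j) ≡ f j) →
  reverse (map f (upTo (suc n))) ≡ map f (upTo (suc n))
map-upTo-palindrome f n mirrored = begin
  reverse (map f (upTo (suc n)))        ≡⟨ cong reverse (map-upTo f (suc n)) ⟩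
  reverse (applyUpTo f (suc n))         ≡⟨ reverse-applyUpTo f (suc n) ⟩
  applyDownFrom f (suc n)               ≡⟨ applyDownFrom-applyUpTo f (suc n) ⟩
  applyUpTo (λ j → f (n ∸ j)) (suc n)   ≡⟨ applyUpTo-cong (suc n) (λ j j<1+n → mirrored j (s≤s⁻¹ j<1+n)) ⟩
  applyUpTo f (suc n)                   ≡⟨ map-upTo f (suc n) ⟨
  map f (upTo (suc n))                  ∎
  where open ≡-Reasoning

m∸[n∸o]≡m∸n+o : ∀ {m n o} → o ≤ n → n ≤ m → m ∸ (n ∸ o) ≡ m ∸ n + o
m∸[n∸o]≡m∸n+o {m} {n} {o} o≤n n≤m = begin
  m ∸ (n ∸ o)             ≡⟨ cong (_∸ (n ∸ o)) (m∸n+n≡m n≤m) ⟨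
  (m ∸ n + n) ∸ (n ∸ o)   ≡⟨ +-∸-assoc (m ∸ n) (m∸n≤m n o) ⟩
  m ∸ n + (n ∸ (n ∸ o))   ≡⟨ cong (m ∸ n +_) (m∸[m∸n]≡n o≤n) ⟩
  m ∸ n + o               ∎
  where open ≡-Reasoning

module _ {s r k : ℕ} (legal : Legal s r k) where

  Legal-receiver≤source : r + k ≤ s ∸ k
  Legal-receiver≤source = m+n≤o⇒m≤o∸n (r + k) (proj₂ legal)

  Legal-amount≤source : k ≤ s
  Legal-amount≤source = m+n≤o⇒n≤o (r + k) (proj₂ legal)

  Legal-bounded : ∀ {c} → s ≤ c → s ∸ k ≤ c × r + k ≤ c
  Legal-bounded s≤c =
    ≤-trans (m∸n≤m s k) s≤c , ≤-trans (≤-trans Legal-receiver≤source (m∸n≤m s k)) s≤c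

  reflect-source : ∀ {c} → s ≤ c → c ∸ (s ∸ k) ≡ c ∸ s + k
  reflect-source = m∸[n∸o]≡m∸n+o Legal-amount≤source

  Legal-reflect : ∀ {c} → s ≤ c → Legal (c ∸ r) (c ∸ s) k
  Legal-reflect {c} s≤c = proj₁ legal , m+n≤o⇒m≤o∸n (c ∸ s + k + k) (begin
    c ∸ s + k + k + r     ≡⟨ shuffle (c ∸ s) r k ⟩
    c ∸ s + (r + k + k)   ≤⟨ +-monoʳ-≤ (c ∸ s) (proj₂ legal) ⟩
    c ∸ s + s             ≡⟨ m∸n+n≡m s≤c ⟩
    c                     ∎)
    where
    open ≤-Reasoning
    shuffle : ∀ d r k → d + k + k + r ≡ d + (r + k + k)
    shuffle = solve-∀

  -- (u + k)² + r² − u² − (r + k)² = 2k(u − r) with u = s ∸ k, stated with 2kr added to both sides.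
  transfer-reduces-squares : (s ∸ k) * (s ∸ k) + (r + k) * (r + k) < s * s + r * r
  transfer-reduces-squares = +-cancelʳ-< (2 * (k * r)) _ _ (begin-strict
    u * u + (r + k) * (r + k) + 2 * (k * r)   <⟨ +-monoʳ-< (u * u + (r + k) * (r + k)) 2kr<2ku ⟩
    u * u + (r + k) * (r + k) + 2 * (k * u)   ≡⟨ spread u r k ⟩
    (u + k) * (u + k) + r * r + 2 * (k * r)   ≡⟨ cong (λ t → t * t + r * r + 2 * (k * r)) u+k≡s ⟩
    s * s + r * r + 2 * (k * r)               ∎)
    where
    open ≤-Reasoning
    u : ℕ
    u = s ∸ k
    u+k≡s : u + k ≡ s
    u+k≡s = m∸n+n≡m Legal-amount≤source
    r<u : r < u
    r<u = <-≤-trans (m<m+n r (proj₁ legal)) Legal-receiver≤source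
    2kr<2ku : 2 * (k * r) < 2 * (k * u)
    2kr<2ku = *-monoʳ-< 2 (*-monoʳ-< k {{>-nonZero (proj₁ legal)}} r<u)
    spread : ∀ u r k →
      u * u + (r + k) * (r + k) + 2 * (k * u) ≡ (u + k) * (u + k) + r * r + 2 * (k * r)
    spread = solve-∀

  transfer-reduces-squares′ : (r + k) * (r + k) + (s ∸ k) * (s ∸ k) < r * r + s * s
  transfer-reduces-squares′ =
    subst₂ _<_ (+-comm ((s ∸ k) * (s ∸ k)) _) (+-comm (s * s) _) transfer-reduces-squares

sumOfSquares : Pos → ℕ
sumOfSquares (x , y , z) = x * x + y * y + z * z

outer-pair-< : ∀ x y z x′ z′ → x′ * x′ + z′ * z′ < x * x + z * z →
  sumOfSquares (x′ , y , z′) < sumOfSquares (x , y , z)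
outer-pair-< x y z x′ z′ lt =
  subst₂ _<_ (xy∙z≈xz∙y (x′ * x′) (z′ * z′) (y * y)) (xy∙z≈xz∙y (x * x) (z * z) (y * y))
    (+-monoˡ-< (y * y) lt)

inner-pair-< : ∀ x y z y′ z′ → y′ * y′ + z′ * z′ < y * y + z * z →
  sumOfSquares (x , y′ , z′) < sumOfSquares (x , y , z)
inner-pair-< x y z y′ z′ lt =
  subst₂ _<_ (sym (+-assoc (x * x) (y′ * y′) (z′ * z′))) (sym (+-assoc (x * x) (y * y) (z * z)))
    (+-monoʳ-< (x * x) lt)

sumOfSquares-decreasing : ∀ {p q} → Move p q → sumOfSquares q < sumOfSquares p
sumOfSquares-decreasing {x , y , z} (xy k legal) =
  +-monoˡ-< (z * z) (transfer-reduces-squares legal)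
sumOfSquares-decreasing {x , y , z} (yx k legal) =
  +-monoˡ-< (z * z) (transfer-reduces-squares′ legal)
sumOfSquares-decreasing {x , y , z} (xz k legal) =
  outer-pair-< x y z (x ∸ k) (z + k) (transfer-reduces-squares legal)
sumOfSquares-decreasing {x , y , z} (zx k legal) =
  outer-pair-< x y z (x + k) (z ∸ k) (transfer-reduces-squares′ legal)
sumOfSquares-decreasing {x , y , z} (yz k legal) =
  inner-pair-< x y z (y ∸ k) (z + k) (transfer-reduces-squares legal)
sumOfSquares-decreasing {x , y , z} (zy k legal) =
  inner-pair-< x y z (y + k) (z ∸ k) (transfer-reduces-squares′ legal)

Bounded : ℕ → Pos → Set
Bounded c (x , y , z) = x ≤ c × y ≤ c × z ≤ c

reflect : ℕ → Pos → Pos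
reflect c (x , y , z) = (c ∸ z , c ∸ y , c ∸ x)

reflect-bounded : ∀ c p → Bounded c (reflect c p)
reflect-bounded c (x , y , z) = m∸n≤m c z , m∸n≤m c y , m∸n≤m c x

reflect-involutive : ∀ {c p} → Bounded c p → reflect c (reflect c p) ≡ p
reflect-involutive (x≤c , y≤c , z≤c) =
  cong₂ _,_ (m∸[m∸n]≡n x≤c) (cong₂ _,_ (m∸[m∸n]≡n y≤c) (m∸[m∸n]≡n z≤c))

move-preserves-bounded : ∀ {c p q} → Bounded c p → Move p q → Bounded c q
move-preserves-bounded (x≤c , y≤c , z≤c) (xy k legal) =
  let x′≤c , y′≤c = Legal-bounded legal x≤c in x′≤c , y′≤c , z≤c
move-preserves-bounded (x≤c , y≤c , z≤c) (xz k legal) =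
  let x′≤c , z′≤c = Legal-bounded legal x≤c in x′≤c , y≤c , z′≤c
move-preserves-bounded (x≤c , y≤c , z≤c) (yx k legal) =
  let y′≤c , x′≤c = Legal-bounded legal y≤c in x′≤c , y′≤c , z≤c
move-preserves-bounded (x≤c , y≤c , z≤c) (yz k legal) =
  let y′≤c , z′≤c = Legal-bounded legal y≤c in x≤c , y′≤c , z′≤c
move-preserves-bounded (x≤c , y≤c , z≤c) (zx k legal) =
  let z′≤c , x′≤c = Legal-bounded legal z≤c in x′≤c , y≤c , z′≤c
move-preserves-bounded (x≤c , y≤c , z≤c) (zy k legal) =
  let z′≤c , y′≤c = Legal-bounded legal z≤c in x≤c , y′≤c , z′≤c

reflect-move : ∀ {c p q} → Bounded c p → Move p q → Move (reflect c p) (reflect c q)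
reflect-move {c} (x≤c , _ , _) (xy {y = y} k legal)
  rewrite reflect-source legal x≤c | sym (∸-+-assoc c y k) = yz k (Legal-reflect legal x≤c)
reflect-move {c} (x≤c , _ , _) (xz {z = z} k legal)
  rewrite reflect-source legal x≤c | sym (∸-+-assoc c z k) = xz k (Legal-reflect legal x≤c)
reflect-move {c} (_ , y≤c , _) (yx {x} k legal)
  rewrite reflect-source legal y≤c | sym (∸-+-assoc c x k) = zy k (Legal-reflect legal y≤c)
reflect-move {c} (_ , y≤c , _) (yz {z = z} k legal)
  rewrite reflect-source legal y≤c | sym (∸-+-assoc c z k) = xy k (Legal-reflect legal y≤c)
reflect-move {c} (_ , _ , z≤c) (zx {x} k legal)
  rewrite reflect-source legal z≤c | sym (∸-+-assoc c x k) = zx k (Legal-reflect legal z≤c)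
reflect-move {c} (_ , _ , z≤c) (zy {y = y} k legal)
  rewrite reflect-source legal z≤c | sym (∸-+-assoc c y k) = yx k (Legal-reflect legal z≤c)

module _ (g : Pos → ℕ) where

  OptionValuesCovered : Pos → Pos → Set
  OptionValuesCovered p p′ = ∀ q → Move p q → ∃ λ q′ → Move p′ q′ × g q′ ≡ g q

  mex-unique : ∀ {p m n} → IsMexOfOptions g p m → IsMexOfOptions g p n → m ≡ n
  mex-unique {m = m} {n} (m-avoided , below-m-attained) (n-avoided , below-n-attained)
    with <-cmp m n
  ... | tri≈ _ m≡n _ = m≡n
  ... | tri< m<n _ _ = let q , mv , gq≡m = below-n-attained m m<n in ⊥-elim (m-avoided q mv gq≡m)
  ... | tri> _ _ n<m = let q , mv , gq≡n = below-m-attained n n<m in ⊥-elim (n-avoided q mv gq≡n)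

  mex-transport : ∀ {p p′ n} → OptionValuesCovered p p′ → OptionValuesCovered p′ p →
    IsMexOfOptions g p n → IsMexOfOptions g p′ n
  mex-transport {p′ = p′} {n} covered covered′ (avoided , attained) = avoided′ , attained′
    where
    avoided′ : ∀ q′ → Move p′ q′ → ¬ (g q′ ≡ n)
    avoided′ q′ mv′ gq′≡n =
      let q , mv , gq≡gq′ = covered′ q′ mv′ in avoided q mv (trans gq≡gq′ gq′≡n)
    attained′ : ∀ m → m < n → ∃ λ q′ → Move p′ q′ × g q′ ≡ m
    attained′ m m<n =
      let q , mv , gq≡m = attained m m<n
          q′ , mv′ , gq′≡gq = covered q mv
      in q′ , mv′ , trans gq′≡gq gq≡m

module GameSymmetry
  (g : Pos → ℕ) (grundy : IsGrundy g)
  (Region : Pos → Set) (σ : Pos → Pos)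
  (move-closed : ∀ {p q} → Region p → Move p q → Region q)
  (σ-closed : ∀ {p} → Region p → Region (σ p))
  (σ-involutive : ∀ {p} → Region p → σ (σ p) ≡ p)
  (σ-move : ∀ {p q} → Region p → Move p q → Move (σ p) (σ q))
  where

  grundy-σ : ∀ {p} → Region p → g (σ p) ≡ g p
  grundy-σ {p} = invariant p (<-wellFounded (sumOfSquares p))
    where
    invariant : ∀ p → Acc _<_ (sumOfSquares p) → Region p → g (σ p) ≡ g p
    invariant p (acc smaller) p∈R =
      mex-unique g (mex-transport g from-σp from-p (grundy (σ p))) (grundy p)
      where
      option-invariant : ∀ {q} → Move p q → g (σ q) ≡ g q
      option-invariant mv = invariant _ (smaller (sumOfSquares-decreasing mv)) (move-closed p∈R mv)
      from-p : OptionValuesCovered g p (σ p)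
      from-p q mv = σ q , σ-move p∈R mv , option-invariant mv
      from-σp : OptionValuesCovered g (σ p) p
      from-σp q′ mv′ = σ q′ , mv , trans (sym (option-invariant mv)) (cong g (σ-involutive q′∈R))
        where
        mv : Move p (σ q′)
        mv = subst (λ p₀ → Move p₀ (σ q′)) (σ-involutive p∈R) (σ-move (σ-closed p∈R) mv′)
        q′∈R : Region q′
        q′∈R = move-closed (σ-closed p∈R) mv′

grundy-reflect : ∀ {g} → IsGrundy g → ∀ {c p} → Bounded c p → g (reflect c p) ≡ g p
grundy-reflect {g} grundy {c} =
  GameSymmetry.grundy-σ g grundy (Bounded c) (reflect c)
    move-preserves-bounded (λ {p} _ → reflect-bounded c p) reflect-involutive reflect-move

grundy-middle-mirror : ∀ {g} → IsGrundy g → ∀ {y z b} → y + z ≡ b → g (0 , z , b) ≡ g (0 , y , b)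
grundy-middle-mirror {g} grundy {y} {z} refl =
  trans (cong₂ (λ u v → g (u , v , y + z)) (sym (n∸n≡0 (y + z))) (sym (m+n∸m≡n y z)))
        (grundy-reflect grundy (z≤n , m≤m+n y z , ≤-refl))

mirror-split : ∀ a {b j} → a + a ≤ b → j ≤ b ∸ a ∸ a → a + j + (a + (b ∸ a ∸ a ∸ j)) ≡ b
mirror-split a {b} {j} 2a≤b j≤n = begin
  a + j + (a + (n ∸ j))     ≡⟨ interchange a j a (n ∸ j) ⟩
  a + a + (j + (n ∸ j))     ≡⟨ cong (a + a +_) (m+[n∸m]≡n j≤n) ⟩
  a + a + n                 ≡⟨ cong (a + a +_) (∸-+-assoc b a a) ⟩
  a + a + (b ∸ (a + a))     ≡⟨ m+[n∸m]≡n 2a≤b ⟩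
  b                         ∎
  where
  open ≡-Reasoning
  n : ℕ
  n = b ∸ a ∸ a

mainTheorem4 : (g : Pos → ℕ) → IsGrundy g → (a b : ℕ) → a + a ≤ b →
    let xs = map (λ j → g (0 , a + j , b)) (upTo (suc (b ∸ a ∸ a))) in
    reverse xs ≡ xs
mainTheorem4 g grundy a b 2a≤b =
  map-upTo-palindrome (λ j → g (0 , a + j , b)) (b ∸ a ∸ a)
    (λ j j≤n → grundy-middle-mirror grundy (mirror-split a 2a≤b j≤n))
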